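{- Let $S$ be a set. For every saturation $\mathcal{A}$ on $S$ and every reduction $\mathcal{J}$ on $S$, $$\mathcal{A}\subseteq \mathbb{A}(\mathcal{J})\iff \mathcal{A}\triangleleft\mathcal{J}\iff \mathcal{J}\subseteq \mathbb{J}(\mathcal{A}).$$ Consequently the maps $\mathbb{A}$ from reductions on $S$ to saturations on $S$ and $\mathbb{J}$ from saturations on $S$ to reductions on $S$ form an antitone Galois connection (with both collections ordered by pointwise inclusion).
   Context: All reasoning is intuitionistic (the law of excluded middle is not assumed); impredicative constructions on power sets are allowed. An operator on $S$ is any map $\mathcal{O}:\mathrm{Pow}(S)\to\mathrm{Pow}(S)$; for operators, $\mathcal{O}_1\subseteq\mathcal{O}_2$ means $\mathcal{O}_1(U)\subseteq\mathcal{O}_2(U)$ for all $U\subseteq S$. For $U,V\subseteq S$ write $U\between V$ for "there exists $a\in S$ with $a\in U\cap V$". For operators $\mathcal{O},\mathcal{O}'$ on $S$, $\mathcal{O}\triangleleft\mathcal{O}'$ ($\mathcal{O}$ is compatible with $\mathcal{O}'$) means: for all $U,V\subseteq S$, $\mathcal{O}(U)\between\mathcal{O}'(V)$ implies $U\between\mathcal{O}'(V)$. A saturation is a monotone idempotent operator $\mathcal{A}$ with $U\subseteq\mathcal{A}(U)$ for all $U$; a reduction is a monotone idempotent operator $\mathcal{J}$ with $\mathcal{J}(U)\subseteq U$ for all $U$. For a reduction $\mathcal{J}$, $\mathbb{A}(\mathcal{J})$ denotes the greatest saturation $\mathcal{A}$ (w.r.t. $\subseteq$) with $\mathcal{A}\triangleleft\mathcal{J}$;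 for a saturation $\mathcal{A}$, $\mathbb{J}(\mathcal{A})$ denotes the greatest reduction $\mathcal{J}$ with $\mathcal{A}\triangleleft\mathcal{J}$ (both exist). -}

module Defs where

open import Level using (Level; suc; _⊔_)
open import Data.Product using (Σ; _×_; _,_)

Pow : ∀ {ℓ} → Set ℓ → Set (suc ℓ)
Pow {ℓ} S = S → Set ℓ

infix 4 _⊆_ _⊆ₒ_ _◁_ _≬_

_⊆_ : ∀ {ℓ} {S : Set ℓ} → Pow S → Pow S → Set ℓ
U ⊆ V = ∀ {a} → U a → V a

_≬_ : ∀ {ℓ} {S : Set ℓ} → Pow S → Pow S → Set ℓ
_≬_ {S = S} U V = Σ S (λ a → U a × V a)

Op : ∀ {ℓ} → Set ℓ → Set (suc ℓ)
Op S = Pow S → Pow S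

_⊆ₒ_ : ∀ {ℓ} {S : Set ℓ} → Op S → Op S → Set (suc ℓ)
O₁ ⊆ₒ O₂ = ∀ U → O₁ U ⊆ O₂ U

_◁_ : ∀ {ℓ} {S : Set ℓ} → Op S → Op S → Set (suc ℓ)
O ◁ O' = ∀ U V → O U ≬ O' V → U ≬ O' V

Monotone : ∀ {ℓ} {S : Set ℓ} → Op S → Set (suc ℓ)
Monotone O = ∀ {U V} → U ⊆ V → O U ⊆ O V

-- idempotent: O (O U) = O U as subsets (extensional equality = mutual inclusion)
Idempotent : ∀ {ℓ} {S : Set ℓ} → Op S → Set (suc ℓ)
Idempotent O = ∀ U → (O (O U) ⊆ O U) × (O U ⊆ O (O U))

IsSaturation : ∀ {ℓ} {S : Set ℓ} → Op S → Set (suc ℓ)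
IsSaturation O = Monotone O × Idempotent O × (∀ U → U ⊆ O U)

IsReduction : ∀ {ℓ} {S : Set ℓ} → Op S → Set (suc ℓ)
IsReduction O = Monotone O × Idempotent O × (∀ U → O U ⊆ U)

IsGreatestSatCompat : ∀ {ℓ} {S : Set ℓ} → Op S → Op S → Set (suc ℓ)
IsGreatestSatCompat J A* =
  IsSaturation A* × (A* ◁ J) × (∀ A → IsSaturation A → A ◁ J → A ⊆ₒ A*)

IsGreatestRedCompat : ∀ {ℓ} {S : Set ℓ} → Op S → Op S → Set (suc ℓ)
IsGreatestRedCompat A J* =
  IsReduction J* × (A ◁ J*) × (∀ J → IsReduction J → A ◁ J → J ⊆ₒ J*)

-- 𝔸 J and 𝕁 A are both defined by a universal property with respect to the single
-- relation A ◁ J, which is antitone in each argument.  For J ⊆ K this is because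
-- J V ⊆ J (J V) ⊆ K (J V) ⊆ V.  So A ⊆ 𝔸 J ⇔ A ◁ J ⇔ J ⊆ 𝕁 A, and antitonicity of
-- 𝔸 and 𝕁 follows as for any Galois connection.
module Submission where

open import Defs
open import Level using (Level)
open import Data.Product using (_×_; _,_; proj₁; proj₂)
open import Function.Bundles using (_⇔_; mk⇔; module Equivalence)
open import Function.Properties.Equivalence using () renaming (trans to ⇔-trans)

module _ {ℓ} {S : Set ℓ} where

  ◁-antitoneˡ : {O O′ K : Op S} → O ⊆ₒ O′ → O′ ◁ K → O ◁ K
  ◁-antitoneˡ O⊆O′ O′◁K U V (a , a∈OU , a∈KV) = O′◁K U V (a , O⊆O′ U a∈OU , a∈KV)

  ◁-antitoneʳ : {O J K : Op S} → (∀ V → J V ⊆ J (J V)) → (∀ V → K V ⊆ V) →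
                J ⊆ₒ K → O ◁ K → O ◁ J
  ◁-antitoneʳ {J = J} J-⊆-J² K-deflationary J⊆K O◁K U V (a , a∈OU , a∈JV)
    with O◁K U (J V) (a , a∈OU , J⊆K (J V) (J-⊆-J² V a∈JV))
  ... | b , b∈U , b∈KJV = b , b∈U , K-deflationary (J V) b∈KJV

  reduction-◁-antitone : {O J K : Op S} → IsReduction J → IsReduction K →
                         J ⊆ₒ K → O ◁ K → O ◁ J
  reduction-◁-antitone (_ , J-idem , _) (_ , _ , K-deflationary) =
    ◁-antitoneʳ (λ V → proj₂ (J-idem V)) K-deflationary

module GaloisConnection {ℓ} {S : Set ℓ} (𝔸 𝕁 : Op S → Op S)
  (𝔸-spec : ∀ J → IsReduction J → IsGreatestSatCompat J (𝔸 J))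
  (𝕁-spec : ∀ A → IsSaturation A → IsGreatestRedCompat A (𝕁 A)) where

  ⊆𝔸⇔◁ : ∀ {A J} → IsSaturation A → IsReduction J → (A ⊆ₒ 𝔸 J) ⇔ (A ◁ J)
  ⊆𝔸⇔◁ {A} {J} sA rJ with 𝔸-spec J rJ
  ... | _ , 𝔸J◁J , 𝔸J-greatest =
    mk⇔ (λ A⊆𝔸J → ◁-antitoneˡ A⊆𝔸J 𝔸J◁J) (𝔸J-greatest A sA)

  ◁⇔⊆𝕁 : ∀ {A J} → IsSaturation A → IsReduction J → (A ◁ J) ⇔ (J ⊆ₒ 𝕁 A)
  ◁⇔⊆𝕁 {A} {J} sA rJ with 𝕁-spec A sA
  ... | r𝕁A , A◁𝕁A , 𝕁A-greatest =
    mk⇔ (𝕁A-greatest J rJ) (λ J⊆𝕁A → reduction-◁-antitone rJ r𝕁A J⊆𝕁A A◁𝕁A)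

  ⊆𝔸⇔⊆𝕁 : ∀ {A J} → IsSaturation A → IsReduction J → (A ⊆ₒ 𝔸 J) ⇔ (J ⊆ₒ 𝕁 A)
  ⊆𝔸⇔⊆𝕁 sA rJ = ⇔-trans (⊆𝔸⇔◁ sA rJ) (◁⇔⊆𝕁 sA rJ)

  𝔸-antitone : ∀ {J₁ J₂} → IsReduction J₁ → IsReduction J₂ → J₁ ⊆ₒ J₂ → 𝔸 J₂ ⊆ₒ 𝔸 J₁
  𝔸-antitone {J₂ = J₂} r₁ r₂ J₁⊆J₂ with 𝔸-spec J₂ r₂
  ... | s𝔸J₂ , 𝔸J₂◁J₂ , _ =
    Equivalence.from (⊆𝔸⇔◁ s𝔸J₂ r₁) (reduction-◁-antitone r₁ r₂ J₁⊆J₂ 𝔸J₂◁J₂)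

  𝕁-antitone : ∀ {A₁ A₂} → IsSaturation A₁ → IsSaturation A₂ → A₁ ⊆ₒ A₂ → 𝕁 A₂ ⊆ₒ 𝕁 A₁
  𝕁-antitone {A₂ = A₂} s₁ s₂ A₁⊆A₂ with 𝕁-spec A₂ s₂
  ... | r𝕁A₂ , A₂◁𝕁A₂ , _ =
    Equivalence.to (◁⇔⊆𝕁 s₁ r𝕁A₂) (◁-antitoneˡ A₁⊆A₂ A₂◁𝕁A₂)

proposition2p12 : ∀ {ℓ : Level} (S : Set ℓ) (𝔸 𝕁 : Op S → Op S)
    → (∀ J → IsReduction J → IsGreatestSatCompat J (𝔸 J))
    → (∀ A → IsSaturation A → IsGreatestRedCompat A (𝕁 A))
    → (∀ A J → IsSaturation A → IsReduction J →
         ((A ⊆ₒ 𝔸 J) ⇔ (A ◁ J)) × ((A ◁ J) ⇔ (J ⊆ₒ 𝕁 A)))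
    × (∀ A J → IsSaturation A → IsReduction J → (A ⊆ₒ 𝔸 J) ⇔ (J ⊆ₒ 𝕁 A))
    × (∀ J₁ J₂ → IsReduction J₁ → IsReduction J₂ → J₁ ⊆ₒ J₂ → 𝔸 J₂ ⊆ₒ 𝔸 J₁)
    × (∀ A₁ A₂ → IsSaturation A₁ → IsSaturation A₂ → A₁ ⊆ₒ A₂ → 𝕁 A₂ ⊆ₒ 𝕁 A₁)
proposition2p12 _ 𝔸 𝕁 𝔸-spec 𝕁-spec =
    (λ _ _ sA rJ → ⊆𝔸⇔◁ sA rJ , ◁⇔⊆𝕁 sA rJ)
  , (λ _ _ → ⊆𝔸⇔⊆𝕁)
  , (λ _ _ → 𝔸-antitone)
  , (λ _ _ → 𝕁-antitone)
  where open GaloisConnection 𝔸 𝕁 𝔸-spec 𝕁-spec
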